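{- Let $u$ and $v$ be two factors of a Sturmian word $\omega$, and let $k\in\mathbb{Z}^+\cup\{+\infty\}$. Then $u\sim_k v$ if and only if $u\,\mathcal R_k\,v$.
   Context: $u\sim_k v$ means $|u|_x=|v|_x$ for all non-empty $x$ with $|x|\le k$ ($|u|_x$ = number of occurrences of $x$ in $u$). $u\,\mathcal R_k\,v$ means: $u,v$ are Abelian equivalent ($|u|_a=|v|_a$ for each letter $a$) and share a common prefix and a common suffix of length $k-1$; if $|u|<k-1$ (in particular if $k=+\infty$) it means $u=v$. A Sturmian word is an infinite binary word with exactly $n+1$ factors of length $n$ for every $n\ge0$. -}

module Defs where

open import Data.Bool using (Bool)
open import Data.Bool.Properties using () renaming (_≟_ to _≟ᵇ_)
open import Data.Nat using (ℕ; zero; suc; _+_; _∸_; _≤_; _<_)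
open import Data.List using (List; []; _∷_; length; map; upTo; _++_)
open import Data.List.Properties using (≡-dec)
open import Data.List.Relation.Unary.All using (All)
open import Data.List.Relation.Unary.Unique.Propositional using (Unique)
open import Data.List.Membership.Propositional using (_∈_)
open import Data.Product using (Σ; ∃; ∃-syntax; _×_)
open import Data.Unit using (⊤)
open import Relation.Binary.PropositionalEquality using (_≡_; _≢_)
open import Relation.Nullary using (yes; no)

Word : Set
Word = List Bool

InfWord : Set
InfWord = ℕ → Bool

-- 1 if x is a prefix of w, else 0
-- occ x w = |w|_x : number of positions i (0 ≤ i ≤ |w|) at which x occurs in w.
-- (Only used for non-empty x.)
prefixCount : Word → Word → ℕ
prefixCount x w with ≡-dec _≟ᵇ_ x (Data.List.take (length x) w)
... | yes _ = 1
... | no  _ = 0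

occ : Word → Word → ℕ
occ x []       = prefixCount x []
occ x (a ∷ w)  = prefixCount x (a ∷ w) + occ x w

-- ℤ⁺ ∪ {+∞}, represented as ℕ ∪ {∞}; positivity is a separate hypothesis.
data ℕ∞ : Set where
  fin : ℕ → ℕ∞
  ∞   : ℕ∞

Positive∞ : ℕ∞ → Set
Positive∞ (fin k) = 1 ≤ k
Positive∞ ∞       = ⊤

_≤∞_ : ℕ → ℕ∞ → Set
n ≤∞ fin k = n ≤ k
n ≤∞ ∞     = ⊤

_∼[_]_ : Word → ℕ∞ → Word → Set
u ∼[ k ] v = (x : Word) → x ≢ [] → length x ≤∞ k → occ x u ≡ occ x v

AbelianEq : Word → Word → Set
AbelianEq u v = (a : Bool) → occ (a ∷ []) u ≡ occ (a ∷ []) v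

CommonPrefix : ℕ → Word → Word → Set
CommonPrefix n u v = ∃[ p ] (length p ≡ n × (∃[ r ] u ≡ p ++ r) × (∃[ r ] v ≡ p ++ r))

CommonSuffix : ℕ → Word → Word → Set
CommonSuffix n u v = ∃[ s ] (length s ≡ n × (∃[ r ] u ≡ r ++ s) × (∃[ r ] v ≡ r ++ s))

R[_] : ℕ∞ → Word → Word → Set
R[ fin k ] u v =
  (length u < k ∸ 1 → u ≡ v) ×
  (k ∸ 1 ≤ length u →
     AbelianEq u v × CommonPrefix (k ∸ 1) u v × CommonSuffix (k ∸ 1) u v)
R[ ∞ ] u v = u ≡ v

slice : InfWord → ℕ → ℕ → Word
slice ω i n = map (λ j → ω (i + j)) (upTo n)

Factor : InfWord → Word → Set
Factor ω w = ∃[ i ] w ≡ slice ω i (length w)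

Sturmian : InfWord → Set
Sturmian ω = (n : ℕ) → ∃[ L ]
  ( length L ≡ suc n
  × Unique L
  × All (λ w → length w ≡ n × Factor ω w) L
  × ((w : Word) → length w ≡ n → Factor ω w → w ∈ L))

-- Counting occurrences by their last letter gives |w|_y = |w|_{y0} + |w|_{y1} + [y is a suffix of w],
-- and by their first letter |w|_x = |w|_{0x} + |w|_{1x} + [x is a prefix of w].  Hence k-binomial
-- equivalence fixes the letter counts and the prefix and suffix of length k - 1, for arbitrary words.
-- Conversely, let u, v be Sturmian factors with u R_k v and assume that every word of length m < k
-- occurs equally often in u and v.  A word y of length m that is not right special has at most one
-- extension ya that is a factor, so the first identity gives |u|_{ya} = |v|_{ya} for both letters.
-- The unique right special factor y of length m is handled by summing |w|_{z1} over all factors z of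
-- length m: the sum counts the 1s of w at positions >= m, which is the same for u and v because they
-- are Abelian equivalent and share a prefix of length m.

module Submission where

open import Defs
open import Function.Bundles using (_⇔_; mk⇔)

open import Data.Bool using (Bool; true; false)
open import Data.Bool.Properties using () renaming (_≟_ to _≟ᵇ_)
open import Data.Empty using (⊥-elim)
open import Data.List
  using (List; []; _∷_; [_]; length; map; _++_; _∷ʳ_; take; drop; applyUpTo; initLast; _∷ʳ′_)
open import Data.List.Properties
  using ( ≡-dec; ∷-injectiveˡ; ∷-injectiveʳ; ∷ʳ-injectiveʳ; length-++-≤ʳ; length-take; length-drop
        ; take++drop≡id; drop-all; take-[]; drop-[]; map-applyUpTo)
open import Data.List.Membership.Propositional using (_∈_)
open import Data.List.Membership.DecPropositional (≡-dec _≟ᵇ_) using (_∈?_)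
open import Data.List.Relation.Unary.All as All using ()
open import Data.List.Relation.Unary.AllPairs using (_∷_)
open import Data.List.Relation.Unary.Any using (here; there)
open import Data.List.Relation.Unary.Unique.Propositional using (Unique)
open import Data.Nat using (ℕ; zero; suc; _+_; _∸_; _≤_; _<_; z≤n; s≤s; _≟_; _≤?_; _<?_)
open import Data.Nat.ListAction using (sum)
open import Data.Nat.Properties
  using ( ≤-refl; ≤-reflexive; ≤-trans; <-trans; <-irrefl; n≮n; n<1+n; n≤1+n; ≰⇒≥; ≮⇒≥
        ; m≤n⇒m≤1+n; m<n⇒m≤1+n; +-identityʳ; +-suc; +-comm; +-mono-≤; +-monoʳ-≤
        ; m≤m+n; m≤n+m; +-cancelˡ-≡; +-cancelʳ-≡; ∸-monoˡ-≤; m+[n∸m]≡n; m∸[m∸n]≡n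
        ; m≤n⇒m⊓n≡m; suc-injective; +-commutativeSemigroup)
open import Algebra.Properties.CommutativeSemigroup +-commutativeSemigroup
  using (interchange; x∙yz≈y∙xz; xy∙z≈y∙xz)
open import Data.Nat.Tactic.RingSolver using (solve-∀)
open import Data.Product using (∃-syntax; _×_; _,_; proj₁; proj₂; map₂)
import Data.Product as Product
open import Data.Unit using (tt)
open import Function using (_∘_)
open import Relation.Binary.Definitions using (DecidableEquality)
open import Relation.Nullary using (¬_; yes; no; contradiction)
open import Relation.Nullary.Decidable using (decidable-stable; map′; _×-dec_)
open import Relation.Unary using (Decidable)
open import Relation.Binary.PropositionalEquality
  using (_≡_; _≢_; refl; sym; trans; cong; cong₂; subst; subst₂; ≢-sym; module ≡-Reasoning)
open ≡-Reasoning

_≟ʷ_ : DecidableEquality Word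
_≟ʷ_ = ≡-dec _≟ᵇ_

length-∷ʳ : ∀ {A : Set} (xs : List A) x → length (xs ∷ʳ x) ≡ suc (length xs)
length-∷ʳ []       x = refl
length-∷ʳ (_ ∷ xs) x = cong suc (length-∷ʳ xs x)

take-length-++ : ∀ {A : Set} (xs ys : List A) → take (length xs) (xs ++ ys) ≡ xs
take-length-++ []       ys = refl
take-length-++ (x ∷ xs) ys = cong (x ∷_) (take-length-++ xs ys)

take-++-≤ : ∀ {A : Set} m (xs ys : List A) → m ≤ length xs → take m (xs ++ ys) ≡ take m xs
take-++-≤ zero    xs       ys _         = refl
take-++-≤ (suc m) (x ∷ xs) ys (s≤s m≤) = cong (x ∷_) (take-++-≤ m xs ys m≤)

+₃≡⇒₃≡ : ∀ {a b s a′ b′ s′} → a ≡ a′ → b ≡ b′ → a + b + s ≡ a′ + b′ + s′ → s ≡ s′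
+₃≡⇒₃≡ {a} {b} refl refl = +-cancelˡ-≡ (a + b) _ _

+₃≡⇒₂≡ : ∀ {a b s a′ b′ s′} → a ≡ a′ → s ≡ s′ → a + b + s ≡ a′ + b′ + s′ → b ≡ b′
+₃≡⇒₂≡ {a} {s = s} refl refl eq = +-cancelˡ-≡ a _ _ (+-cancelʳ-≡ s _ _ eq)

+₃≡⇒₁≡ : ∀ {a b s a′ b′ s′} → b ≡ b′ → s ≡ s′ → a + b + s ≡ a′ + b′ + s′ → a ≡ a′
+₃≡⇒₁≡ {b = b} {s} refl refl eq = +-cancelʳ-≡ b _ _ (+-cancelʳ-≡ s _ _ eq)

χ-prefix : Word → Word → ℕ
χ-prefix []          _           = 1
χ-prefix (_ ∷ _)     []          = 0
χ-prefix (false ∷ x) (false ∷ w) = χ-prefix x w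
χ-prefix (true ∷ x)  (true ∷ w)  = χ-prefix x w
χ-prefix (false ∷ _) (true ∷ _)  = 0
χ-prefix (true ∷ _)  (false ∷ _) = 0

δ : Word → Word → ℕ
δ []          []          = 1
δ []          (_ ∷ _)     = 0
δ (_ ∷ _)     []          = 0
δ (false ∷ x) (false ∷ w) = δ x w
δ (true ∷ x)  (true ∷ w)  = δ x w
δ (false ∷ _) (true ∷ _)  = 0
δ (true ∷ _)  (false ∷ _) = 0

χ-suffix : Word → Word → ℕ
χ-suffix x []      = δ x []
χ-suffix x (a ∷ w) = δ x (a ∷ w) + χ-suffix x w

χ-prefix-++ : ∀ x r → χ-prefix x (x ++ r) ≡ 1
χ-prefix-++ []          r = refl
χ-prefix-++ (false ∷ x) r = χ-prefix-++ x r
χ-prefix-++ (true ∷ x)  r = χ-prefix-++ x r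

χ-prefix≢0⇒prefix : ∀ x w → χ-prefix x w ≢ 0 → ∃[ r ] w ≡ x ++ r
χ-prefix≢0⇒prefix []          w           _   = w , refl
χ-prefix≢0⇒prefix (_ ∷ _)     []          χ≢0 = ⊥-elim (χ≢0 refl)
χ-prefix≢0⇒prefix (false ∷ x) (false ∷ w) χ≢0 = map₂ (cong (false ∷_)) (χ-prefix≢0⇒prefix x w χ≢0)
χ-prefix≢0⇒prefix (true ∷ x)  (true ∷ w)  χ≢0 = map₂ (cong (true ∷_)) (χ-prefix≢0⇒prefix x w χ≢0)
χ-prefix≢0⇒prefix (false ∷ _) (true ∷ _)  χ≢0 = ⊥-elim (χ≢0 refl)
χ-prefix≢0⇒prefix (true ∷ _)  (false ∷ _) χ≢0 = ⊥-elim (χ≢0 refl)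

χ-prefix-short : ∀ x w → length w < length x → χ-prefix x w ≡ 0
χ-prefix-short []          _           ()
χ-prefix-short (_ ∷ _)     []          _         = refl
χ-prefix-short (false ∷ x) (false ∷ w) (s≤s w<x) = χ-prefix-short x w w<x
χ-prefix-short (true ∷ x)  (true ∷ w)  (s≤s w<x) = χ-prefix-short x w w<x
χ-prefix-short (false ∷ _) (true ∷ _)  _         = refl
χ-prefix-short (true ∷ _)  (false ∷ _) _         = refl

χ-prefix-sameLength : ∀ x w → length x ≡ length w → χ-prefix x w ≡ δ x w
χ-prefix-sameLength []          []          _  = refl
χ-prefix-sameLength (false ∷ x) (false ∷ w) eq = χ-prefix-sameLength x w (suc-injective eq)
χ-prefix-sameLength (true ∷ x)  (true ∷ w)  eq = χ-prefix-sameLength x w (suc-injective eq)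
χ-prefix-sameLength (false ∷ _) (true ∷ _)  _  = refl
χ-prefix-sameLength (true ∷ _)  (false ∷ _) _  = refl

χ-prefix-∷ʳ : ∀ y w → χ-prefix y w ≡ χ-prefix (y ∷ʳ false) w + χ-prefix (y ∷ʳ true) w + δ y w
χ-prefix-∷ʳ []          []          = refl
χ-prefix-∷ʳ []          (false ∷ _) = refl
χ-prefix-∷ʳ []          (true ∷ _)  = refl
χ-prefix-∷ʳ (_ ∷ _)     []          = refl
χ-prefix-∷ʳ (false ∷ y) (false ∷ w) = χ-prefix-∷ʳ y w
χ-prefix-∷ʳ (true ∷ y)  (true ∷ w)  = χ-prefix-∷ʳ y w
χ-prefix-∷ʳ (false ∷ _) (true ∷ _)  = refl
χ-prefix-∷ʳ (true ∷ _)  (false ∷ _) = refl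

χ-prefix-++-cancel : ∀ p x w → χ-prefix (p ++ x) (p ++ w) ≡ χ-prefix x w
χ-prefix-++-cancel []          x w = refl
χ-prefix-++-cancel (false ∷ p) x w = χ-prefix-++-cancel p x w
χ-prefix-++-cancel (true ∷ p)  x w = χ-prefix-++-cancel p x w

χ-prefix-++-mismatch : ∀ z p x w → length z ≡ length p → z ≢ p → χ-prefix (z ++ x) (p ++ w) ≡ 0
χ-prefix-++-mismatch []          []          x w _  z≢p = ⊥-elim (z≢p refl)
χ-prefix-++-mismatch (false ∷ z) (false ∷ p) x w eq z≢p =
  χ-prefix-++-mismatch z p x w (suc-injective eq) (z≢p ∘ cong (false ∷_))
χ-prefix-++-mismatch (true ∷ z)  (true ∷ p)  x w eq z≢p =
  χ-prefix-++-mismatch z p x w (suc-injective eq) (z≢p ∘ cong (true ∷_))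
χ-prefix-++-mismatch (false ∷ _) (true ∷ _)  x w _  _   = refl
χ-prefix-++-mismatch (true ∷ _)  (false ∷ _) x w _  _   = refl

χ-prefix-letter : ∀ b a t t′ → χ-prefix [ b ] (a ∷ t) ≡ χ-prefix [ b ] (a ∷ t′)
χ-prefix-letter false false _ _ = refl
χ-prefix-letter false true  _ _ = refl
χ-prefix-letter true  false _ _ = refl
χ-prefix-letter true  true  _ _ = refl

δ-refl : ∀ x → δ x x ≡ 1
δ-refl []          = refl
δ-refl (false ∷ x) = δ-refl x
δ-refl (true ∷ x)  = δ-refl x

δ≢0⇒≡ : ∀ x w → δ x w ≢ 0 → x ≡ w
δ≢0⇒≡ []          []          _   = refl
δ≢0⇒≡ []          (_ ∷ _)     δ≢0 = ⊥-elim (δ≢0 refl)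
δ≢0⇒≡ (_ ∷ _)     []          δ≢0 = ⊥-elim (δ≢0 refl)
δ≢0⇒≡ (false ∷ x) (false ∷ w) δ≢0 = cong (false ∷_) (δ≢0⇒≡ x w δ≢0)
δ≢0⇒≡ (true ∷ x)  (true ∷ w)  δ≢0 = cong (true ∷_) (δ≢0⇒≡ x w δ≢0)
δ≢0⇒≡ (false ∷ _) (true ∷ _)  δ≢0 = ⊥-elim (δ≢0 refl)
δ≢0⇒≡ (true ∷ _)  (false ∷ _) δ≢0 = ⊥-elim (δ≢0 refl)

δ-≢ : ∀ x w → x ≢ w → δ x w ≡ 0
δ-≢ x w x≢w = decidable-stable (δ x w ≟ 0) (x≢w ∘ δ≢0⇒≡ x w)

δ-take-∷ʳ : ∀ {m} z c → length z ≡ m → δ z (take m (z ∷ʳ c)) ≡ 1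
δ-take-∷ʳ z c refl = trans (cong (δ z) (take-length-++ z [ c ])) (δ-refl z)

χ-suffix-[] : ∀ w → χ-suffix [] w ≡ 1
χ-suffix-[] []      = refl
χ-suffix-[] (_ ∷ w) = χ-suffix-[] w

χ-suffix-short : ∀ s w → length w < length s → χ-suffix s w ≡ 0
χ-suffix-short (_ ∷ _) [] _ = refl
χ-suffix-short s (a ∷ w) w<s =
  cong₂ _+_ (δ-≢ s (a ∷ w) (λ s≡ → <-irrefl (cong length (sym s≡)) w<s))
            (χ-suffix-short s w (<-trans (n<1+n _) w<s))

χ-suffix-++ˡ : ∀ y r s → length y ≤ length s → χ-suffix y (r ++ s) ≡ χ-suffix y s
χ-suffix-++ˡ y []      s _    = refl
χ-suffix-++ˡ y (a ∷ r) s y≤s =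
  trans (cong (_+ χ-suffix y (r ++ s)) (δ-≢ y (a ∷ r ++ s) (λ y≡ → <-irrefl (cong length y≡) y<)))
        (χ-suffix-++ˡ y r s y≤s)
  where
  y< : length y < length (a ∷ r ++ s)
  y< = s≤s (≤-trans y≤s (length-++-≤ʳ s {r}))

χ-suffix-++ : ∀ r s → χ-suffix s (r ++ s) ≡ 1
χ-suffix-++ r s = trans (χ-suffix-++ˡ s r s ≤-refl) (self s)
  where
  self : ∀ s → χ-suffix s s ≡ 1
  self []      = refl
  self (a ∷ s) = cong₂ _+_ (δ-refl (a ∷ s)) (χ-suffix-short (a ∷ s) s ≤-refl)

χ-suffix≢0⇒suffix : ∀ s w → χ-suffix s w ≢ 0 → ∃[ r ] w ≡ r ++ s
χ-suffix≢0⇒suffix s [] χ≢0 = [] , sym (δ≢0⇒≡ s [] χ≢0)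
χ-suffix≢0⇒suffix s (a ∷ w) χ≢0 with δ s (a ∷ w) ≟ 0
... | no  δ≢0 = [] , sym (δ≢0⇒≡ s (a ∷ w) δ≢0)
... | yes δ≡0 = Product.map (a ∷_) (cong (a ∷_))
                  (χ-suffix≢0⇒suffix s w (χ≢0 ∘ cong₂ _+_ δ≡0))

-- Occurrence counts

count : Word → Word → ℕ
count x []      = χ-prefix x []
count x (a ∷ w) = χ-prefix x (a ∷ w) + count x w

prefixCount≡χ-prefix : ∀ x w → prefixCount x w ≡ χ-prefix x w
prefixCount≡χ-prefix x w with ≡-dec _≟ᵇ_ x (take (length x) w)
... | yes x≡ = sym (begin
  χ-prefix x w                              ≡⟨ cong (χ-prefix x) (sym (take++drop≡id (length x) w)) ⟩
  χ-prefix x (take (length x) w ++ rest)    ≡⟨ cong (λ p → χ-prefix x (p ++ rest)) (sym x≡) ⟩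
  χ-prefix x (x ++ rest)                    ≡⟨ χ-prefix-++ x rest ⟩
  1                                         ∎)
  where rest = drop (length x) w
... | no x≢ = sym (decidable-stable (χ-prefix x w ≟ 0) λ χ≢0 →
  let r , w≡ = χ-prefix≢0⇒prefix x w χ≢0
  in x≢ (sym (trans (cong (take (length x)) w≡) (take-length-++ x r))))

occ≡count : ∀ x w → occ x w ≡ count x w
occ≡count x []      = prefixCount≡χ-prefix x []
occ≡count x (a ∷ w) = cong₂ _+_ (prefixCount≡χ-prefix x (a ∷ w)) (occ≡count x w)

count-short : ∀ x w → length w < length x → count x w ≡ 0
count-short x []      w<x = χ-prefix-short x [] w<x
count-short x (a ∷ w) w<x =
  cong₂ _+_ (χ-prefix-short x (a ∷ w) w<x) (count-short x w (<-trans (n<1+n _) w<x))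

count-sameLength : ∀ x w → length x ≡ length w → count x w ≡ δ x w
count-sameLength x []      eq = χ-prefix-sameLength x [] eq
count-sameLength x (a ∷ w) eq = begin
  χ-prefix x (a ∷ w) + count x w ≡⟨ cong₂ _+_ (χ-prefix-sameLength x (a ∷ w) eq)
                                              (count-short x w (≤-reflexive (sym eq))) ⟩
  δ x (a ∷ w) + 0                ≡⟨ +-identityʳ _ ⟩
  δ x (a ∷ w)                    ∎

count-[] : ∀ w → count [] w ≡ suc (length w)
count-[] []      = refl
count-[] (_ ∷ w) = cong suc (count-[] w)

count-∷ʳ : ∀ y w → count y w ≡ count (y ∷ʳ false) w + count (y ∷ʳ true) w + χ-suffix y w
count-∷ʳ y []      = χ-prefix-∷ʳ y []
count-∷ʳ y (a ∷ w) = begin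
  χ-prefix y (a ∷ w) + count y w
    ≡⟨ cong₂ _+_ (χ-prefix-∷ʳ y (a ∷ w)) (count-∷ʳ y w) ⟩
  (p₀ + p₁ + d) + (c₀ + c₁ + s)
    ≡⟨ interchange (p₀ + p₁) d (c₀ + c₁) s ⟩
  (p₀ + p₁) + (c₀ + c₁) + (d + s)
    ≡⟨ cong (_+ (d + s)) (interchange p₀ p₁ c₀ c₁) ⟩
  (p₀ + c₀) + (p₁ + c₁) + (d + s)
    ∎
  where
  p₀ = χ-prefix (y ∷ʳ false) (a ∷ w)
  p₁ = χ-prefix (y ∷ʳ true) (a ∷ w)
  d  = δ y (a ∷ w)
  c₀ = count (y ∷ʳ false) w
  c₁ = count (y ∷ʳ true) w
  s  = χ-suffix y w

count-∷ : ∀ x w → count x w ≡ count (false ∷ x) w + count (true ∷ x) w + χ-prefix x w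
count-∷ x []          = refl
count-∷ x (false ∷ w) =
  trans (cong (χ-prefix x (false ∷ w) +_) (count-∷ x w))
        (shuffle (χ-prefix x (false ∷ w)) (count (false ∷ x) w) (count (true ∷ x) w) (χ-prefix x w))
  where
  shuffle : ∀ p c₀ c₁ q → p + (c₀ + c₁ + q) ≡ q + c₀ + (0 + c₁) + p
  shuffle = solve-∀
count-∷ x (true ∷ w)  =
  trans (cong (χ-prefix x (true ∷ w) +_) (count-∷ x w))
        (shuffle (χ-prefix x (true ∷ w)) (count (false ∷ x) w) (count (true ∷ x) w) (χ-prefix x w))
  where
  shuffle : ∀ p c₀ c₁ q → p + (c₀ + c₁ + q) ≡ 0 + c₀ + (q + c₁) + p
  shuffle = solve-∀

count-letters : ∀ w → suc (length w) ≡ count [ false ] w + count [ true ] w + 1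
count-letters w = begin
  suc (length w)                                         ≡⟨ sym (count-[] w) ⟩
  count [] w                                             ≡⟨ count-∷ʳ [] w ⟩
  count [ false ] w + count [ true ] w + χ-suffix [] w   ≡⟨ cong (letters +_) (χ-suffix-[] w) ⟩
  count [ false ] w + count [ true ] w + 1               ∎
  where letters = count [ false ] w + count [ true ] w

letterCounts⇒length : ∀ {u v} → count [ false ] u ≡ count [ false ] v →
                      count [ true ] u ≡ count [ true ] v → length u ≡ length v
letterCounts⇒length {u} {v} eq₀ eq₁ = suc-injective (begin
  suc (length u)                           ≡⟨ count-letters u ⟩
  count [ false ] u + count [ true ] u + 1 ≡⟨ cong₂ (λ a b → a + b + 1) eq₀ eq₁ ⟩
  count [ false ] v + count [ true ] v + 1 ≡⟨ sym (count-letters v) ⟩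
  suc (length v)                           ∎)

count-take-suc : ∀ b m w →
                 count [ b ] (take (suc m) w) ≡ χ-prefix [ b ] (drop m w) + count [ b ] (take m w)
count-take-suc b zero    []      = refl
count-take-suc b zero    (a ∷ w) = cong (_+ 0) (χ-prefix-letter b a [] w)
count-take-suc b (suc m) []      = refl
count-take-suc b (suc m) (a ∷ w) = begin
  χ-prefix [ b ] (a ∷ take (suc m) w) + count [ b ] (take (suc m) w)
    ≡⟨ cong₂ _+_ (χ-prefix-letter b a _ (take m w)) (count-take-suc b m w) ⟩
  χ-prefix [ b ] (a ∷ take m w) + (χ-prefix [ b ] (drop m w) + count [ b ] (take m w))
    ≡⟨ x∙yz≈y∙xz (χ-prefix [ b ] (a ∷ take m w)) (χ-prefix [ b ] (drop m w)) _ ⟩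
  χ-prefix [ b ] (drop m w) + (χ-prefix [ b ] (a ∷ take m w) + count [ b ] (take m w))
    ∎

count-∷ʳ-both : ∀ y u v c → count y u ≡ count y v → χ-suffix y u ≡ χ-suffix y v →
                count (y ∷ʳ c) u ≡ count (y ∷ʳ c) v → ∀ c′ → count (y ∷ʳ c′) u ≡ count (y ∷ʳ c′) v
count-∷ʳ-both y u v c y≡ s≡ = both c
  where
  balance : count (y ∷ʳ false) u + count (y ∷ʳ true) u + χ-suffix y u
          ≡ count (y ∷ʳ false) v + count (y ∷ʳ true) v + χ-suffix y v
  balance = trans (sym (count-∷ʳ y u)) (trans y≡ (count-∷ʳ y v))
  both : ∀ c → count (y ∷ʳ c) u ≡ count (y ∷ʳ c) v → ∀ c′ → count (y ∷ʳ c′) u ≡ count (y ∷ʳ c′) v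
  both false eq false = eq
  both true  eq true  = eq
  both false eq true  = +₃≡⇒₂≡ eq s≡ balance
  both true  eq false = +₃≡⇒₁≡ eq s≡ balance

-- k-binomial equivalence determines the letter counts, prefix and suffix

infix 4 _≈[_]_
_≈[_]_ : Word → ℕ → Word → Set
u ≈[ n ] v = ∀ x → x ≢ [] → length x ≤ n → count x u ≡ count x v

∼⇒≈ : ∀ {u v} n → u ∼[ fin n ] v → u ≈[ n ] v
∼⇒≈ {u} {v} n u∼v x x≢[] x≤n = trans (sym (occ≡count x u)) (trans (u∼v x x≢[] x≤n) (occ≡count x v))

≈⇒∼ : ∀ {u v} n → u ≈[ n ] v → u ∼[ fin n ] v
≈⇒∼ {u} {v} n u≈v x x≢[] x≤n = trans (occ≡count x u) (trans (u≈v x x≢[] x≤n) (sym (occ≡count x v)))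

≈⇒AbelianEq : ∀ {u v n} → u ≈[ suc n ] v → AbelianEq u v
≈⇒AbelianEq {u} {v} {n} u≈v a = ≈⇒∼ {u} {v} (suc n) u≈v [ a ] (λ ()) (s≤s z≤n)

≈⇒length : ∀ {u v n} → u ≈[ suc n ] v → length u ≡ length v
≈⇒length {u} {v} u≈v =
  letterCounts⇒length {u} {v} (u≈v [ false ] (λ ()) (s≤s z≤n)) (u≈v [ true ] (λ ()) (s≤s z≤n))

≈⇒≡ : ∀ {u v n} → length u ≤ suc n → u ≈[ suc n ] v → u ≡ v
≈⇒≡ {[]}    {[]}    _ _   = refl
≈⇒≡ {[]}    {w@(_ ∷ _)} _ u≈v with () ← ≈⇒length {[]} {w} u≈v
≈⇒≡ {a ∷ u} {v}     u≤n u≈v = δ≢0⇒≡ (a ∷ u) v (subst (_≢ 0) (sym δ≡1) (λ ()))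
  where
  δ≡1 : δ (a ∷ u) v ≡ 1
  δ≡1 = begin
    δ (a ∷ u) v            ≡⟨ sym (count-sameLength (a ∷ u) v (≈⇒length {a ∷ u} {v} u≈v)) ⟩
    count (a ∷ u) v        ≡⟨ sym (u≈v (a ∷ u) (λ ()) u≤n) ⟩
    count (a ∷ u) (a ∷ u)  ≡⟨ count-sameLength (a ∷ u) (a ∷ u) refl ⟩
    δ (a ∷ u) (a ∷ u)      ≡⟨ δ-refl (a ∷ u) ⟩
    1                      ∎

≈⇒χ-prefix : ∀ {u v} p → u ≈[ suc (length p) ] v → χ-prefix p u ≡ χ-prefix p v
≈⇒χ-prefix     []      _   = refl
≈⇒χ-prefix {u} {v} (a ∷ p) u≈v =
  +₃≡⇒₃≡ (u≈v (false ∷ a ∷ p) (λ ()) ≤-refl) (u≈v (true ∷ a ∷ p) (λ ()) ≤-refl)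
         (trans (sym (count-∷ x u)) (trans (u≈v x (λ ()) (n≤1+n (length x))) (count-∷ x v)))
  where x = a ∷ p

≈⇒χ-suffix : ∀ {u v} s → u ≈[ suc (length s) ] v → χ-suffix s u ≡ χ-suffix s v
≈⇒χ-suffix {u} {v} []      _   = trans (χ-suffix-[] u) (sym (χ-suffix-[] v))
≈⇒χ-suffix {u} {v} (a ∷ s) u≈v =
  +₃≡⇒₃≡ (extension false) (extension true)
         (trans (sym (count-∷ʳ x u)) (trans (u≈v x (λ ()) (n≤1+n (length x))) (count-∷ʳ x v)))
  where
  x = a ∷ s
  extension : ∀ c → count (x ∷ʳ c) u ≡ count (x ∷ʳ c) v
  extension c = u≈v (x ∷ʳ c) (λ ()) (≤-reflexive (length-∷ʳ x c))

≈⇒CommonPrefix : ∀ {u v k} → k ≤ length u → u ≈[ suc k ] v → CommonPrefix k u v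
≈⇒CommonPrefix {u} {v} {k} k≤u u≈v =
  p , |p|≡k , (drop k u , sym (take++drop≡id k u))
    , χ-prefix≢0⇒prefix p v (subst (_≢ 0) (sym χ≡1) (λ ()))
  where
  p = take k u
  |p|≡k : length p ≡ k
  |p|≡k = trans (length-take k u) (m≤n⇒m⊓n≡m k≤u)
  χ≡1 : χ-prefix p v ≡ 1
  χ≡1 = begin
    χ-prefix p v                   ≡⟨ ≈⇒χ-prefix {u} {v} p (subst (λ n → u ≈[ suc n ] v) (sym |p|≡k) u≈v) ⟨
    χ-prefix p u                   ≡⟨ cong (χ-prefix p) (sym (take++drop≡id k u)) ⟩
    χ-prefix p (p ++ drop k u)     ≡⟨ χ-prefix-++ p (drop k u) ⟩
    1                              ∎

≈⇒CommonSuffix : ∀ {u v k} → k ≤ length u → u ≈[ suc k ] v → CommonSuffix k u v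
≈⇒CommonSuffix {u} {v} {k} k≤u u≈v =
  s , |s|≡k , (r , sym (take++drop≡id (length u ∸ k) u))
    , χ-suffix≢0⇒suffix s v (subst (_≢ 0) (sym χ≡1) (λ ()))
  where
  r = take (length u ∸ k) u
  s = drop (length u ∸ k) u
  |s|≡k : length s ≡ k
  |s|≡k = trans (length-drop (length u ∸ k) u) (m∸[m∸n]≡n k≤u)
  χ≡1 : χ-suffix s v ≡ 1
  χ≡1 = begin
    χ-suffix s v          ≡⟨ ≈⇒χ-suffix {u} {v} s (subst (λ n → u ≈[ suc n ] v) (sym |s|≡k) u≈v) ⟨
    χ-suffix s u          ≡⟨ cong (χ-suffix s) (sym (take++drop≡id (length u ∸ k) u)) ⟩
    χ-suffix s (r ++ s)   ≡⟨ χ-suffix-++ r s ⟩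
    1                     ∎

≈⇒R : ∀ {u v k} → u ≈[ suc k ] v → R[ fin (suc k) ] u v
≈⇒R {u} {v} u≈v =
    (λ u<k → ≈⇒≡ {u} {v} (m<n⇒m≤1+n u<k) u≈v)
  , (λ k≤u → ≈⇒AbelianEq {u} {v} u≈v , ≈⇒CommonPrefix k≤u u≈v , ≈⇒CommonSuffix k≤u u≈v)

CommonPrefix⇒take≡ : ∀ {u v k m} → CommonPrefix k u v → m ≤ k → take m u ≡ take m v
CommonPrefix⇒take≡ {u} {v} {m = m} (p , |p|≡k , (r , u≡) , (r′ , v≡)) m≤k = begin
  take m u         ≡⟨ cong (take m) u≡ ⟩
  take m (p ++ r)  ≡⟨ take-++-≤ m p r m≤p ⟩
  take m p         ≡⟨ sym (take-++-≤ m p r′ m≤p) ⟩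
  take m (p ++ r′) ≡⟨ cong (take m) (sym v≡) ⟩
  take m v         ∎
  where
  m≤p = subst (m ≤_) (sym |p|≡k) m≤k

CommonSuffix⇒χ-suffix≡ : ∀ {u v k y} → CommonSuffix k u v → length y ≤ k → χ-suffix y u ≡ χ-suffix y v
CommonSuffix⇒χ-suffix≡ {u} {v} {y = y} (s , |s|≡k , (r , u≡) , (r′ , v≡)) y≤k = begin
  χ-suffix y u          ≡⟨ cong (χ-suffix y) u≡ ⟩
  χ-suffix y (r ++ s)   ≡⟨ χ-suffix-++ˡ y r s y≤s ⟩
  χ-suffix y s          ≡⟨ sym (χ-suffix-++ˡ y r′ s y≤s) ⟩
  χ-suffix y (r′ ++ s)  ≡⟨ cong (χ-suffix y) (sym v≡) ⟩
  χ-suffix y v          ∎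
  where
  y≤s = subst (length y ≤_) (sym |s|≡k) y≤k

∑ : {A : Set} → List A → (A → ℕ) → ℕ
∑ L f = sum (map f L)

module _ {A : Set} where

  ∑-cong : ∀ (L : List A) {f g : A → ℕ} → (∀ {z} → z ∈ L → f z ≡ g z) → ∑ L f ≡ ∑ L g
  ∑-cong []      f≡g = refl
  ∑-cong (a ∷ L) f≡g = cong₂ _+_ (f≡g (here refl)) (∑-cong L (f≡g ∘ there))

  ∑-zero : ∀ (L : List A) {f : A → ℕ} → (∀ {z} → z ∈ L → f z ≡ 0) → ∑ L f ≡ 0
  ∑-zero []      _   = refl
  ∑-zero (a ∷ L) f≡0 = cong₂ _+_ (f≡0 (here refl)) (∑-zero L (f≡0 ∘ there))

  ∑-1 : ∀ (L : List A) → ∑ L (λ _ → 1) ≡ length L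
  ∑-1 []      = refl
  ∑-1 (_ ∷ L) = cong suc (∑-1 L)

  ∑-+ : ∀ (L : List A) (f g : A → ℕ) → ∑ L (λ z → f z + g z) ≡ ∑ L f + ∑ L g
  ∑-+ []      f g = refl
  ∑-+ (a ∷ L) f g = trans (cong (f a + g a +_) (∑-+ L f g)) (interchange (f a) (g a) (∑ L f) (∑ L g))

  ∑-≥-term : ∀ {L : List A} (f : A → ℕ) {z} → z ∈ L → f z ≤ ∑ L f
  ∑-≥-term f (here refl) = m≤m+n _ _
  ∑-≥-term f (there z∈)  = ≤-trans (∑-≥-term f z∈) (m≤n+m _ _)

  ∑-≥-pair : ∀ {L : List A} (f : A → ℕ) {y y′} → y ≢ y′ → y ∈ L → y′ ∈ L → f y + f y′ ≤ ∑ L f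
  ∑-≥-pair f y≢y′ (here refl) (here refl) = ⊥-elim (y≢y′ refl)
  ∑-≥-pair f y≢y′ (here refl) (there y′∈) = +-monoʳ-≤ (f _) (∑-≥-term f y′∈)
  ∑-≥-pair {a ∷ L} f {y} y≢y′ (there y∈) (here refl) =
    subst (_≤ f a + ∑ L f) (+-comm (f a) (f y)) (+-monoʳ-≤ (f a) (∑-≥-term f y∈))
  ∑-≥-pair f y≢y′ (there y∈)  (there y′∈) = ≤-trans (∑-≥-pair f y≢y′ y∈ y′∈) (m≤n+m _ _)

  ∑-≥-2+length : ∀ {L : List A} (e : A → ℕ) {y y′} → (∀ {z} → z ∈ L → 1 ≤ e z) →
                 y ≢ y′ → y ∈ L → y′ ∈ L → 2 ≤ e y → 2 ≤ e y′ → 2 + length L ≤ ∑ L e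
  ∑-≥-2+length {L} e e≥1 y≢y′ y∈ y′∈ 2≤y 2≤y′ =
    subst₂ _≤_ (+-comm (length L) 2) (sym split) (+-monoʳ-≤ (length L) excess)
    where
    excess : 2 ≤ ∑ L (λ z → e z ∸ 1)
    excess = ≤-trans (+-mono-≤ (∸-monoˡ-≤ 1 2≤y) (∸-monoˡ-≤ 1 2≤y′))
                     (∑-≥-pair (λ z → e z ∸ 1) y≢y′ y∈ y′∈)
    split : ∑ L e ≡ length L + ∑ L (λ z → e z ∸ 1)
    split = begin
      ∑ L e                               ≡⟨ ∑-cong L (sym ∘ m+[n∸m]≡n ∘ e≥1) ⟩
      ∑ L (λ z → 1 + (e z ∸ 1))           ≡⟨ ∑-+ L (λ _ → 1) (λ z → e z ∸ 1) ⟩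
      ∑ L (λ _ → 1) + ∑ L (λ z → e z ∸ 1) ≡⟨ cong (_+ ∑ L (λ z → e z ∸ 1)) (∑-1 L) ⟩
      length L + ∑ L (λ z → e z ∸ 1)      ∎

  ∑-single : ∀ {L : List A} {f : A → ℕ} {p} → Unique L → p ∈ L → (∀ {z} → z ∈ L → z ≢ p → f z ≡ 0) →
             ∑ L f ≡ f p
  ∑-single {a ∷ L} {f} (a∉L ∷ _) (here refl) others =
    trans (cong (f a +_) (∑-zero L (λ z∈ → others (there z∈) (≢-sym (All.lookup a∉L z∈)))))
          (+-identityʳ (f a))
  ∑-single {a ∷ L} {f} (a∉L ∷ L-unique) (there p∈) others =
    cong₂ _+_ (others (here refl) (All.lookup a∉L p∈)) (∑-single L-unique p∈ (others ∘ there))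

  ∑-cancel : ∀ {L : List A} {f g : A → ℕ} {y} → Unique L → y ∈ L → (∀ {z} → z ∈ L → z ≢ y → f z ≡ g z) →
             ∑ L f ≡ ∑ L g → f y ≡ g y
  ∑-cancel {a ∷ L} {f} {g} (a∉L ∷ _) (here refl) others ∑≡ =
    +-cancelʳ-≡ (∑ L f) (f a) (g a)
      (trans ∑≡ (cong (g a +_) (sym (∑-cong L (λ z∈ → others (there z∈) (≢-sym (All.lookup a∉L z∈)))))))
  ∑-cancel {a ∷ L} {f} {g} (a∉L ∷ L-unique) (there y∈) others ∑≡ =
    ∑-cancel L-unique y∈ (others ∘ there)
      (+-cancelˡ-≡ (f a) (∑ L f) (∑ L g) (trans ∑≡ (cong (_+ ∑ L g) (sym fa≡ga))))
    where
    fa≡ga : f a ≡ g a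
    fa≡ga = others (here refl) (All.lookup a∉L y∈)

∑-comm : ∀ {A B : Set} (L : List A) (K : List B) (f : A → B → ℕ) →
         ∑ L (λ a → ∑ K (f a)) ≡ ∑ K (λ b → ∑ L (λ a → f a b))
∑-comm []      K f = sym (∑-zero K (λ _ → refl))
∑-comm (a ∷ L) K f = begin
  ∑ K (f a) + ∑ L (λ a′ → ∑ K (f a′))           ≡⟨ cong (∑ K (f a) +_) (∑-comm L K f) ⟩
  ∑ K (f a) + ∑ K (λ b → ∑ L (λ a′ → f a′ b))   ≡⟨ sym (∑-+ K (f a) (λ b → ∑ L (λ a′ → f a′ b))) ⟩
  ∑ K (λ b → f a b + ∑ L (λ a′ → f a′ b))       ∎

window : InfWord → ℕ → ℕ → Word
window ω i zero    = []
window ω i (suc n) = ω i ∷ window ω (suc i) n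

applyUpTo≡window : ∀ ω (f : ℕ → Bool) i n → (∀ j → f j ≡ ω (i + j)) → applyUpTo f n ≡ window ω i n
applyUpTo≡window ω f i zero    _  = refl
applyUpTo≡window ω f i (suc n) f≡ =
  cong₂ _∷_ (trans (f≡ 0) (cong ω (+-identityʳ i)))
            (applyUpTo≡window ω (f ∘ suc) (suc i) n (λ j → trans (f≡ (suc j)) (cong ω (+-suc i j))))

slice≡window : ∀ ω i n → slice ω i n ≡ window ω i n
slice≡window ω i n =
  trans (map-applyUpTo (λ j → j) (λ j → ω (i + j)) n) (applyUpTo≡window ω _ i n (λ _ → refl))

window-suc : ∀ ω i n → window ω i (suc n) ≡ window ω i n ∷ʳ ω (i + n)
window-suc ω i zero    = cong (λ j → [ ω j ]) (sym (+-identityʳ i))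
window-suc ω i (suc n) =
  cong (ω i ∷_) (trans (window-suc ω (suc i) n)
                       (cong (λ j → window ω (suc i) n ∷ʳ ω j) (sym (+-suc i n))))

window-++ˡ : ∀ ω x r i → x ++ r ≡ window ω i (length (x ++ r)) → x ≡ window ω i (length x)
window-++ˡ ω []      r i _  = refl
window-++ˡ ω (a ∷ x) r i eq = cong₂ _∷_ (∷-injectiveˡ eq) (window-++ˡ ω x r (suc i) (∷-injectiveʳ eq))

module FactorProperties (ω : InfWord) where

  Factor⇒window : ∀ {w} → Factor ω w → ∃[ i ] w ≡ window ω i (length w)
  Factor⇒window (i , w≡) = i , trans w≡ (slice≡window ω i _)

  window⇒Factor : ∀ {w} → ∃[ i ] w ≡ window ω i (length w) → Factor ω w
  window⇒Factor (i , w≡) = i , trans w≡ (sym (slice≡window ω i _))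

  Factor-tail : ∀ {a w} → Factor ω (a ∷ w) → Factor ω w
  Factor-tail fw = let i , w≡ = Factor⇒window fw in window⇒Factor (suc i , ∷-injectiveʳ w≡)

  Factor-++ˡ : ∀ x {r} → Factor ω (x ++ r) → Factor ω x
  Factor-++ˡ x {r} fw = let i , w≡ = Factor⇒window fw in window⇒Factor (i , window-++ˡ ω x r i w≡)

  Factor-∷ʳ : ∀ {z} → Factor ω z → ∃[ c ] Factor ω (z ∷ʳ c)
  Factor-∷ʳ {z} fz = ω (i + length z) , window⇒Factor (i , (begin
    z ∷ʳ ω (i + length z)                     ≡⟨ cong (_∷ʳ ω (i + length z)) z≡ ⟩
    window ω i (length z) ∷ʳ ω (i + length z) ≡⟨ sym (window-suc ω i (length z)) ⟩
    window ω i (suc (length z))               ≡⟨ cong (window ω i) (sym (length-∷ʳ z _)) ⟩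
    window ω i (length (z ∷ʳ ω (i + length z))) ∎))
    where
    i = proj₁ (Factor⇒window fz)
    z≡ = proj₂ (Factor⇒window fz)

  count≢0⇒Factor : ∀ {x w} → Factor ω w → count x w ≢ 0 → Factor ω x
  count≢0⇒Factor {x} {[]} fw count≢0 =
    let r , []≡ = χ-prefix≢0⇒prefix x [] count≢0 in Factor-++ˡ x (subst (Factor ω) []≡ fw)
  count≢0⇒Factor {x} {a ∷ w} fw count≢0 with χ-prefix x (a ∷ w) ≟ 0
  ... | yes χ≡0 = count≢0⇒Factor (Factor-tail fw) (count≢0 ∘ cong₂ _+_ χ≡0)
  ... | no  χ≢0 =
    let r , w≡ = χ-prefix≢0⇒prefix x (a ∷ w) χ≢0 in Factor-++ˡ x (subst (Factor ω) w≡ fw)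

  count-nonFactor : ∀ {x w} → Factor ω w → ¬ Factor ω x → count x w ≡ 0
  count-nonFactor {x} {w} fw ¬fx = decidable-stable (count x w ≟ 0) (¬fx ∘ count≢0⇒Factor fw)

RightSpecial : InfWord → Word → Set
RightSpecial ω z = Factor ω (z ∷ʳ false) × Factor ω (z ∷ʳ true)

-- Factors of a Sturmian word

module SturmianFactors (ω : InfWord) (sturmian : Sturmian ω) where

  open FactorProperties ω

  factors : ℕ → List Word
  factors n = proj₁ (sturmian n)

  factors-length : ∀ n → length (factors n) ≡ suc n
  factors-length n = proj₁ (proj₂ (sturmian n))

  factors-unique : ∀ n → Unique (factors n)
  factors-unique n = proj₁ (proj₂ (proj₂ (sturmian n)))

  ∈factors⇒length : ∀ {n w} → w ∈ factors n → length w ≡ n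
  ∈factors⇒length {n} w∈ = proj₁ (All.lookup (proj₁ (proj₂ (proj₂ (proj₂ (sturmian n))))) w∈)

  ∈factors⇒Factor : ∀ {n w} → w ∈ factors n → Factor ω w
  ∈factors⇒Factor {n} w∈ = proj₂ (All.lookup (proj₁ (proj₂ (proj₂ (proj₂ (sturmian n))))) w∈)

  Factor⇒∈factors : ∀ {n w} → length w ≡ n → Factor ω w → w ∈ factors n
  Factor⇒∈factors {n} {w} = proj₂ (proj₂ (proj₂ (proj₂ (sturmian n)))) w

  Factor? : Decidable (Factor ω)
  Factor? w = map′ ∈factors⇒Factor (Factor⇒∈factors refl) (w ∈? factors (length w))

  rightSpecial? : Decidable (RightSpecial ω)
  rightSpecial? z = Factor? (z ∷ʳ false) ×-dec Factor? (z ∷ʳ true)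

  rightSpecial⇒∈factors : ∀ {m z} → length z ≡ m → RightSpecial ω z → z ∈ factors m
  rightSpecial⇒∈factors {z = z} |z| (f₀ , _) = Factor⇒∈factors |z| (Factor-++ˡ z {[ false ]} f₀)

  extensions : ℕ → Word → ℕ
  extensions m z = ∑ (factors (suc m)) (λ w → δ z (take m w))

  take-∈factors : ∀ {m w} → w ∈ factors (suc m) → take m w ∈ factors m
  take-∈factors {m} {w} w∈ =
    Factor⇒∈factors |take| (Factor-++ˡ (take m w) (subst (Factor ω) (sym (take++drop≡id m w)) fw))
    where
    fw = ∈factors⇒Factor {suc m} w∈
    |take| : length (take m w) ≡ m
    |take| = trans (length-take m w)
                   (m≤n⇒m⊓n≡m (subst (m ≤_) (sym (∈factors⇒length {suc m} w∈)) (n≤1+n m)))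

  ∑-extensions : ∀ m → ∑ (factors m) (extensions m) ≡ 2 + m
  ∑-extensions m = begin
    ∑ (factors m) (extensions m)
      ≡⟨ ∑-comm (factors m) (factors (suc m)) (λ z w → δ z (take m w)) ⟩
    ∑ (factors (suc m)) (λ w → ∑ (factors m) (λ z → δ z (take m w)))
      ≡⟨ ∑-cong (factors (suc m)) (prefix-once ∘ take-∈factors) ⟩
    ∑ (factors (suc m)) (λ _ → 1)
      ≡⟨ ∑-1 (factors (suc m)) ⟩
    length (factors (suc m))
      ≡⟨ factors-length (suc m) ⟩
    2 + m
      ∎
    where
    prefix-once : ∀ {p} → p ∈ factors m → ∑ (factors m) (λ z → δ z p) ≡ 1
    prefix-once {p} p∈ = trans (∑-single (factors-unique m) p∈ (λ {z} _ → δ-≢ z p)) (δ-refl p)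

  extensions-pos : ∀ {m z} → z ∈ factors m → 1 ≤ extensions m z
  extensions-pos {m} {z} z∈ =
    subst (_≤ extensions m z) (δ-take-∷ʳ z c |z|)
          (∑-≥-term {L = factors (suc m)} (λ w → δ z (take m w)) zc∈)
    where
    |z| = ∈factors⇒length {m} z∈
    extension = Factor-∷ʳ (∈factors⇒Factor {m} z∈)
    c = proj₁ extension
    zc∈ : z ∷ʳ c ∈ factors (suc m)
    zc∈ = Factor⇒∈factors (trans (length-∷ʳ z c) (cong suc |z|)) (proj₂ extension)

  rightSpecial⇒extensions≥2 : ∀ {m z} → length z ≡ m → RightSpecial ω z → 2 ≤ extensions m z
  rightSpecial⇒extensions≥2 {m} {z} |z| (f₀ , f₁) =
    subst (_≤ extensions m z) (cong₂ _+_ (δ-take-∷ʳ z false |z|) (δ-take-∷ʳ z true |z|))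
      (∑-≥-pair {L = factors (suc m)} (λ w → δ z (take m w)) z0≢z1 (extension∈ f₀) (extension∈ f₁))
    where
    extension∈ : ∀ {c} → Factor ω (z ∷ʳ c) → z ∷ʳ c ∈ factors (suc m)
    extension∈ {c} = Factor⇒∈factors (trans (length-∷ʳ z c) (cong suc |z|))
    z0≢z1 : z ∷ʳ false ≢ z ∷ʳ true
    z0≢z1 eq = contradiction (∷ʳ-injectiveʳ z z eq) λ ()

  -- Every factor of length m has a right extension, and there are only m + 2 extensions in total.
  rightSpecial-unique : ∀ {y y′} → length y ≡ length y′ →
                        RightSpecial ω y → RightSpecial ω y′ → y ≡ y′
  rightSpecial-unique {y} {y′} |y|≡|y′| sp sp′ = decidable-stable (y ≟ʷ y′) λ y≢y′ →
    n≮n (2 + m) (subst₂ _≤_ (cong (2 +_) (factors-length m)) (∑-extensions m)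
      (∑-≥-2+length (extensions m) extensions-pos y≢y′
        (rightSpecial⇒∈factors refl sp) (rightSpecial⇒∈factors (sym |y|≡|y′|) sp′)
        (rightSpecial⇒extensions≥2 refl sp) (rightSpecial⇒extensions≥2 (sym |y|≡|y′|) sp′)))
    where
    m = length y

  -- Among the factors z of length m, only z = take m t can make z ∷ʳ b a prefix of t.
  ∑-χ-prefix-∷ʳ : ∀ m b {t} → Factor ω t →
                  ∑ (factors m) (λ z → χ-prefix (z ∷ʳ b) t) ≡ χ-prefix [ b ] (drop m t)
  ∑-χ-prefix-∷ʳ m b {t} ft with m ≤? length t
  ... | no m≰t =
    trans (∑-zero (factors m) too-long) (cong (χ-prefix [ b ]) (sym (drop-all m t (≰⇒≥ m≰t))))
    where
    too-long : ∀ {z} → z ∈ factors m → χ-prefix (z ∷ʳ b) t ≡ 0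
    too-long {z} z∈ = χ-prefix-short (z ∷ʳ b) t (subst (length t <_) (sym |zb|) (s≤s (≰⇒≥ m≰t)))
      where
      |zb| = trans (length-∷ʳ z b) (cong suc (∈factors⇒length {m} z∈))
  ... | yes m≤t = begin
    ∑ (factors m) (λ z → χ-prefix (z ∷ʳ b) t)
      ≡⟨ cong (λ t′ → ∑ (factors m) (λ z → χ-prefix (z ∷ʳ b) t′)) (sym (take++drop≡id m t)) ⟩
    ∑ (factors m) (λ z → χ-prefix (z ∷ʳ b) (p ++ d))
      ≡⟨ ∑-single (factors-unique m) p∈ mismatch ⟩
    χ-prefix (p ∷ʳ b) (p ++ d)
      ≡⟨ χ-prefix-++-cancel p [ b ] d ⟩
    χ-prefix [ b ] d
      ∎
    where
    p = take m t
    d = drop m t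
    |p| : length p ≡ m
    |p| = trans (length-take m t) (m≤n⇒m⊓n≡m m≤t)
    p∈ : p ∈ factors m
    p∈ = Factor⇒∈factors |p| (Factor-++ˡ p {d} (subst (Factor ω) (sym (take++drop≡id m t)) ft))
    mismatch : ∀ {z} → z ∈ factors m → z ≢ p → χ-prefix (z ∷ʳ b) (p ++ d) ≡ 0
    mismatch {z} z∈ = χ-prefix-++-mismatch z p [ b ] d (trans (∈factors⇒length {m} z∈) (sym |p|))

  ∑-count-∷ʳ : ∀ m b {w} → Factor ω w →
               ∑ (factors m) (λ z → count (z ∷ʳ b) w) + count [ b ] (take m w) ≡ count [ b ] w
  ∑-count-∷ʳ m b {[]} fw =
    cong₂ _+_ (trans (∑-χ-prefix-∷ʳ m b fw) (cong (χ-prefix [ b ]) (drop-[] m)))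
              (cong (count [ b ]) (take-[] m))
  ∑-count-∷ʳ m b {a ∷ w} fw = begin
    ∑ F (λ z → χ-prefix (z ∷ʳ b) (a ∷ w) + count (z ∷ʳ b) w) + T
      ≡⟨ cong (_+ T) (∑-+ F (λ z → χ-prefix (z ∷ʳ b) (a ∷ w)) (λ z → count (z ∷ʳ b) w)) ⟩
    ∑ F (λ z → χ-prefix (z ∷ʳ b) (a ∷ w)) + S + T
      ≡⟨ cong (λ n → n + S + T) (∑-χ-prefix-∷ʳ m b fw) ⟩
    χ-prefix [ b ] (drop m (a ∷ w)) + S + T
      ≡⟨ xy∙z≈y∙xz (χ-prefix [ b ] (drop m (a ∷ w))) S T ⟩
    S + (χ-prefix [ b ] (drop m (a ∷ w)) + T)
      ≡⟨ cong (S +_) (sym (count-take-suc b m (a ∷ w))) ⟩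
    S + (χ-prefix [ b ] (a ∷ take m w) + count [ b ] (take m w))
      ≡⟨ cong (λ n → S + (n + count [ b ] (take m w))) (χ-prefix-letter b a (take m w) w) ⟩
    S + (χ-prefix [ b ] (a ∷ w) + count [ b ] (take m w))
      ≡⟨ x∙yz≈y∙xz S (χ-prefix [ b ] (a ∷ w)) (count [ b ] (take m w)) ⟩
    χ-prefix [ b ] (a ∷ w) + (S + count [ b ] (take m w))
      ≡⟨ cong (χ-prefix [ b ] (a ∷ w) +_) (∑-count-∷ʳ m b (Factor-tail fw)) ⟩
    χ-prefix [ b ] (a ∷ w) + count [ b ] w
      ∎
    where
    F = factors m
    S = ∑ F (λ z → count (z ∷ʳ b) w)
    T = count [ b ] (take m (a ∷ w))

  module _ {u v : Word} (fu : Factor ω u) (fv : Factor ω v) {m : ℕ}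
           (count≡ : ∀ {y} → length y ≡ m → count y u ≡ count y v)
           (suffix≡ : ∀ {y} → length y ≡ m → χ-suffix y u ≡ χ-suffix y v) where

    nonFactor-count≡ : ∀ {x} → ¬ Factor ω x → count x u ≡ count x v
    nonFactor-count≡ ¬fx = trans (count-nonFactor fu ¬fx) (sym (count-nonFactor fv ¬fx))

    nonSpecial⇒count-∷ʳ≡ : ∀ {y} → length y ≡ m → ¬ RightSpecial ω y →
                           ∀ c → count (y ∷ʳ c) u ≡ count (y ∷ʳ c) v
    nonSpecial⇒count-∷ʳ≡ {y} |y| ¬sp with Factor? (y ∷ʳ false)
    ... | no ¬f₀ = count-∷ʳ-both y u v false (count≡ |y|) (suffix≡ |y|) (nonFactor-count≡ ¬f₀)
    ... | yes f₀ = count-∷ʳ-both y u v true  (count≡ |y|) (suffix≡ |y|) (nonFactor-count≡ (¬sp ∘ (f₀ ,_)))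

    count-∷ʳ≡ : ∑ (factors m) (λ z → count (z ∷ʳ true) u)
                ≡ ∑ (factors m) (λ z → count (z ∷ʳ true) v) →
                ∀ {y} → length y ≡ m → ∀ c → count (y ∷ʳ c) u ≡ count (y ∷ʳ c) v
    count-∷ʳ≡ ∑≡ {y} |y| with rightSpecial? y
    ... | no ¬sp = nonSpecial⇒count-∷ʳ≡ |y| ¬sp
    ... | yes sp = count-∷ʳ-both y u v true (count≡ |y|) (suffix≡ |y|)
                     (∑-cancel (factors-unique m) (rightSpecial⇒∈factors |y| sp) others ∑≡)
      where
      others : ∀ {z} → z ∈ factors m → z ≢ y → count (z ∷ʳ true) u ≡ count (z ∷ʳ true) v
      others {z} z∈ z≢y = nonSpecial⇒count-∷ʳ≡ |z|
        (λ spz → z≢y (rightSpecial-unique (trans |z| (sym |y|)) spz sp)) true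
        where
        |z| = ∈factors⇒length {m} z∈

  R⇒count≡ : ∀ {u v k} → Factor ω u → Factor ω v →
             AbelianEq u v → CommonPrefix k u v → CommonSuffix k u v →
             ∀ {y} → length y ≤ suc k → count y u ≡ count y v
  R⇒count≡ {u} {v} {k} fu fv ab cp cs {y} y≤ = count≡-length (length y) y≤ refl
    where
    letter : ∀ a → count [ a ] u ≡ count [ a ] v
    letter a = trans (sym (occ≡count [ a ] u)) (trans (ab a) (occ≡count [ a ] v))
    count≡-length : ∀ m → m ≤ suc k → ∀ {y} → length y ≡ m → count y u ≡ count y v
    count≡-length zero _ {[]} _ = begin
      count [] u     ≡⟨ count-[] u ⟩
      suc (length u) ≡⟨ cong suc (letterCounts⇒length {u} {v} (letter false) (letter true)) ⟩
      suc (length v) ≡⟨ sym (count-[] v) ⟩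
      count [] v     ∎
    count≡-length (suc m) (s≤s m≤k) {y} |y| with initLast y
    ... | z ∷ʳ′ c = count-∷ʳ≡ fu fv (count≡-length m (m≤n⇒m≤1+n m≤k)) suffix≡ ∑≡ |z| c
      where
      |z| : length z ≡ m
      |z| = suc-injective (trans (sym (length-∷ʳ z c)) |y|)
      suffix≡ : ∀ {x} → length x ≡ m → χ-suffix x u ≡ χ-suffix x v
      suffix≡ {x} |x| = CommonSuffix⇒χ-suffix≡ {u} {v} {k} {x} cs (subst (_≤ k) (sym |x|) m≤k)
      ∑≡ : ∑ (factors m) (λ z → count (z ∷ʳ true) u) ≡ ∑ (factors m) (λ z → count (z ∷ʳ true) v)
      ∑≡ = +-cancelʳ-≡ (count [ true ] (take m u)) _ _ (begin
        ∑ (factors m) (λ z → count (z ∷ʳ true) u) + count [ true ] (take m u) ≡⟨ ∑-count-∷ʳ m true fu ⟩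
        count [ true ] u                                                      ≡⟨ letter true ⟩
        count [ true ] v                                                      ≡⟨ ∑-count-∷ʳ m true fv ⟨
        ∑ (factors m) (λ z → count (z ∷ʳ true) v) + count [ true ] (take m v) ≡⟨ cong (_ +_) take≡ ⟨
        ∑ (factors m) (λ z → count (z ∷ʳ true) v) + count [ true ] (take m u) ∎)
        where take≡ = cong (count [ true ]) (CommonPrefix⇒take≡ cp m≤k)

  R⇒≈ : ∀ {u v k} → Factor ω u → Factor ω v → R[ fin (suc k) ] u v → u ≈[ suc k ] v
  R⇒≈ {u} {v} {k} fu fv (short , long) with length u <? k
  ... | yes u<k = λ x _ _ → cong (count x) (short u<k)
  ... | no  u≮k = let ab , cp , cs = long (≮⇒≥ u≮k) in λ _ _ → R⇒count≡ fu fv ab cp cs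

corollary15 : (ω : InfWord) → Sturmian ω → (u v : Word) → Factor ω u → Factor ω v →
    (k : ℕ∞) → Positive∞ k → (u ∼[ k ] v) ⇔ R[ k ] u v
corollary15 ω sturmian u v fu fv (fin zero)    ()
corollary15 ω sturmian u v fu fv (fin (suc k)) _ =
  mk⇔ (≈⇒R {u} {v} ∘ ∼⇒≈ {u} {v} (suc k)) (≈⇒∼ {u} {v} (suc k) ∘ R⇒≈ fu fv)
  where open SturmianFactors ω sturmian
corollary15 ω sturmian u v fu fv ∞ _ =
  mk⇔ (λ u∼v → ≈⇒≡ {u} {v} (n≤1+n (length u)) (∼⇒≈ {u} {v} _ (λ x x≢[] _ → u∼v x x≢[] tt)))
      (λ u≡v x _ _ → cong (occ x) u≡v)
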